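{- Let $t$ be a tiling of the $n$-board with $k$ dominoes and $\ell$ black squares. Write $t$ as its sequence of tiles from left to right, and let $T$ be the tiling obtained by keeping the white squares in their places in this tile sequence and reversing the order of the subsequence formed by the dominoes and black squares. Let $A$ be the tiling of the $n$-board obtained from $T$ by replacing every square (white or black) by a colourless square of weight $1$, and let $B$ be the tiling of the $(n-2k)$-board obtained from $T$ by deleting all dominoes. Then $$w_r(t)=q^{k\ell}\,w_r(A)\,w_r(B).$$
   Context: Let $q$ be a real number with $q\neq -1$ and $r$ a parameter. The $n$-board consists of cells numbered $1,\dots,n$. A tiling is a covering of all cells by non-overlapping tiles, each tile being a white square (one cell), a black square (one cell), a colourless square (one cell), or a domino (two adjacent cells $i-1,i$). The weight $w_r$: a white square has weight $x$; a black square at position $i$ has weight $q^irx$; a colourless square has weight $1$; a domino covering positions $i-1,i$ has weight $q^{i-1}s$; the weight of a tiling is the product of the weights of its tiles. -}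

module Defs where

open import Level using (Level)
open import Data.Nat using (ℕ; zero; suc; _+_)
open import Data.Bool using (Bool; true; false)
open import Data.List using (List; []; _∷_; reverse; filterᵇ)
open import Algebra.Bundles using (CommutativeRing)

data Tile : Set where
  white black colourless domino : Tile

len : Tile → ℕ
len domino = 2
len _      = 1

-- Total number of cells covered by a tile sequence (left to right).
-- A list ts is a tiling of the n-board iff  cells ts ≡ n.
cells : List Tile → ℕ
cells [] = 0
cells (t ∷ ts) = len t + cells ts

isDomino : Tile → Bool
isDomino domino = true
isDomino _      = false

isBlack : Tile → Bool
isBlack black = true
isBlack _     = false

-- dominoes and black squares (the tiles whose order is reversed)
isMoving : Tile → Bool
isMoving domino = true
isMoving black  = true
isMoving _      = false

notDomino : Tile → Bool
notDomino domino = false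
notDomino _      = true

count : (Tile → Bool) → List Tile → ℕ
count p [] = 0
count p (t ∷ ts) with p t
... | true  = suc (count p ts)
... | false = count p ts

refill : List Tile → List Tile → List Tile
refill [] ms = []
refill (t ∷ ts) ms with isMoving t | ms
... | false | _        = t ∷ refill ts ms
... | true  | m ∷ ms'  = m ∷ refill ts ms'
... | true  | []       = t ∷ refill ts []

reverseMoving : List Tile → List Tile
reverseMoving ts = refill ts (reverse (filterᵇ isMoving ts))

decolour : Tile → Tile
decolour domino = domino
decolour _      = colourless

deleteDominoes : List Tile → List Tile
deleteDominoes = filterᵇ notDomino

module Weight {c ℓ : Level} (R : CommutativeRing c ℓ) where
  open CommutativeRing R

  infixr 8 _^_
  _^_ : Carrier → ℕ → Carrier
  a ^ zero  = 1#
  a ^ suc n = a * (a ^ n)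

  -- weightFrom q r x s p ts : weight of tiles ts placed after p already
  -- covered cells (so the next cell has index p + 1).
  weightFrom : (q r x s : Carrier) → ℕ → List Tile → Carrier
  weightFrom q r x s p [] = 1#
  weightFrom q r x s p (white ∷ ts)      = x * weightFrom q r x s (suc p) ts
  weightFrom q r x s p (black ∷ ts)      = ((q ^ suc p) * r * x) * weightFrom q r x s (suc p) ts
  weightFrom q r x s p (colourless ∷ ts) = weightFrom q r x s (suc p) ts
  -- domino covering cells i-1 = p+1 and i = p+2 has weight q^(i-1) s
  weightFrom q r x s p (domino ∷ ts)     = ((q ^ suc p) * s) * weightFrom q r x s (suc (suc p)) ts

  w : (q r x s : Carrier) → List Tile → Carrier
  w q r x s = weightFrom q r x s 0

-- Write w_r(t) = q ^ deg t · π t, where π t is the product of the q-free tile weights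
-- (x, r x, 1, s) and deg t is the sum of the first cells of the black squares and dominoes.
-- π does not see the order of the tiles and splits tile by tile between A and B, so
-- π t = π T = π A · π B.  In every degree, a black square or domino at a given slot
-- sits one cell after the white and colourless squares before that slot (the same in t,
-- A and B) plus the cells of the black squares and dominoes before it.  A pair of tiles of
-- the same kind contributes equally to deg t and to deg A + deg B, while a pair formed
-- by a domino and a black square contributes exactly one more to deg t, whichever comes
-- first in t.  Hence deg t = k ℓ + deg A + deg B.
module Submission where

open import Defs
open import Level using (Level)
open import Data.Nat using (ℕ) renaming (_*_ to _*ℕ_)
open import Data.List using (List; map)
open import Relation.Binary.PropositionalEquality using (_≡_)
open import Relation.Nullary using (¬_)
open import Algebra.Bundles using (CommutativeRing)

open import Data.Bool using (true; false; T; not)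
open import Data.Bool.Properties using (T?)
open import Data.Nat using (zero; suc; _+_)
open import Data.Nat.Properties
  using (suc-injective; +-suc; +-identityʳ; +-assoc; *-zeroʳ; +-commutativeSemigroup)
open import Data.Nat.Tactic.RingSolver using (solve-∀)
open import Data.List using ([]; _∷_; _++_; [_]; reverse; filterᵇ; length; foldr)
open import Data.List.Properties using (unfold-reverse; reverse-involutive; length-reverse)
open import Data.List.Relation.Unary.All using (All; []; _∷_)
open import Data.List.Relation.Unary.All.Properties using (all-filter)
open import Data.List.Relation.Binary.Permutation.Propositional as Perm
  using (_↭_; ↭-refl; ↭-prep; ↭-sym; ↭-trans; ↭⇒↭ₛ′; module PermutationReasoning)
open import Data.List.Relation.Binary.Permutation.Propositional.Properties
  using (↭-reverse; ++⁺ˡ; shift; All-resp-↭; map⁺)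
import Data.List.Relation.Binary.Permutation.Setoid.Properties as SetoidPermutation
import Algebra.Properties.CommutativeSemigroup as CommutativeSemigroupProperties
import Relation.Binary.Reasoning.Setoid as SetoidReasoning
open import Function using (_∘_)
open import Relation.Binary.PropositionalEquality
  using (refl; sym; trans; cong; cong₂; module ≡-Reasoning)

open CommutativeSemigroupProperties +-commutativeSemigroup
  using () renaming (x∙yz≈y∙xz to +-leftComm; x∙yz≈yx∙z to +-rotate)

count-∷ : ∀ p x xs → count p (x ∷ xs) ≡ count p [ x ] + count p xs
count-∷ p x xs with p x
... | true  = refl
... | false = refl

count-↭ : ∀ p {xs ys} → xs ↭ ys → count p xs ≡ count p ys
count-↭ p Perm.refl = refl
count-↭ p (Perm.prep x xs↭ys) with p x
... | true  = cong suc (count-↭ p xs↭ys)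
... | false = count-↭ p xs↭ys
count-↭ p (Perm.swap {xs} {ys} x y xs↭ys) = begin
  count p (x ∷ y ∷ xs)          ≡⟨ count-∷ p x (y ∷ xs) ⟩
  cx + count p (y ∷ xs)         ≡⟨ cong (cx +_) (count-∷ p y xs) ⟩
  cx + (cy + count p xs)        ≡⟨ +-leftComm cx cy (count p xs) ⟩
  cy + (cx + count p xs)        ≡⟨ cong (λ n → cy + (cx + n)) (count-↭ p xs↭ys) ⟩
  cy + (cx + count p ys)        ≡⟨ cong (cy +_) (count-∷ p x ys) ⟨
  cy + count p (x ∷ ys)         ≡⟨ count-∷ p y (x ∷ ys) ⟨
  count p (y ∷ x ∷ ys)          ∎
  where
  open ≡-Reasoning
  cx = count p [ x ]
  cy = count p [ y ]
count-↭ p (Perm.trans xs↭ys ys↭zs) = trans (count-↭ p xs↭ys) (count-↭ p ys↭zs)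

count-filterᵇ-isMoving : ∀ p → p white ≡ false → p colourless ≡ false →
                         ∀ ts → count p (filterᵇ isMoving ts) ≡ count p ts
count-filterᵇ-isMoving p pw pc [] = refl
count-filterᵇ-isMoving p pw pc (white ∷ ts) rewrite pw = count-filterᵇ-isMoving p pw pc ts
count-filterᵇ-isMoving p pw pc (colourless ∷ ts) rewrite pc = count-filterᵇ-isMoving p pw pc ts
count-filterᵇ-isMoving p pw pc (black ∷ ts) with p black
... | true  = cong suc (count-filterᵇ-isMoving p pw pc ts)
... | false = count-filterᵇ-isMoving p pw pc ts
count-filterᵇ-isMoving p pw pc (domino ∷ ts) with p domino
... | true  = cong suc (count-filterᵇ-isMoving p pw pc ts)
... | false = count-filterᵇ-isMoving p pw pc ts

length-filterᵇ : ∀ p xs → length (filterᵇ p xs) ≡ count p xs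
length-filterᵇ p [] = refl
length-filterᵇ p (x ∷ xs) with p x
... | true  = cong suc (length-filterᵇ p xs)
... | false = length-filterᵇ p xs

↭-prep-shift : ∀ {a} {A : Set a} (m : A) {xs ys zs} → xs ↭ ys ++ zs → m ∷ xs ↭ ys ++ m ∷ zs
↭-prep-shift m {ys = ys} {zs} xs↭ = ↭-trans (↭-prep m xs↭) (↭-sym (shift m ys zs))

Moving : List Tile → Set
Moving = All (T ∘ isMoving)

refill-filterᵇ-isMoving : ∀ ts → refill ts (filterᵇ isMoving ts) ≡ ts
refill-filterᵇ-isMoving []                = refl
refill-filterᵇ-isMoving (white ∷ ts)      = cong (white ∷_) (refill-filterᵇ-isMoving ts)
refill-filterᵇ-isMoving (black ∷ ts)      = cong (black ∷_) (refill-filterᵇ-isMoving ts)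
refill-filterᵇ-isMoving (colourless ∷ ts) = cong (colourless ∷_) (refill-filterᵇ-isMoving ts)
refill-filterᵇ-isMoving (domino ∷ ts)     = cong (domino ∷_) (refill-filterᵇ-isMoving ts)

refill-↭ : ∀ ts ms → length ms ≡ count isMoving ts →
           refill ts ms ↭ filterᵇ (not ∘ isMoving) ts ++ ms
refill-↭ []                []       _ = ↭-refl
refill-↭ (white ∷ ts)      ms       h = ↭-prep white (refill-↭ ts ms h)
refill-↭ (colourless ∷ ts) ms       h = ↭-prep colourless (refill-↭ ts ms h)
refill-↭ (black ∷ ts)      (m ∷ ms) h = ↭-prep-shift m (refill-↭ ts ms (suc-injective h))
refill-↭ (domino ∷ ts)     (m ∷ ms) h = ↭-prep-shift m (refill-↭ ts ms (suc-injective h))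
refill-↭ []                (_ ∷ _)  ()
refill-↭ (black ∷ _)       []       ()
refill-↭ (domino ∷ _)      []       ()

reverseMoving-↭ : ∀ ts → reverseMoving ts ↭ ts
reverseMoving-↭ ts = begin
  refill ts (reverse M)       ↭⟨ refill-↭ ts (reverse M) (trans (length-reverse M) ∣M∣) ⟩
  still ++ reverse M          ↭⟨ ++⁺ˡ still (↭-reverse M) ⟩
  still ++ M                  ↭⟨ refill-↭ ts M ∣M∣ ⟨
  refill ts M                 ≡⟨ refill-filterᵇ-isMoving ts ⟩
  ts                          ∎
  where
  open PermutationReasoning
  M = filterᵇ isMoving ts
  still = filterᵇ (not ∘ isMoving) ts
  ∣M∣ = length-filterᵇ isMoving ts

qDegree : ℕ → List Tile → ℕ
qDegree p []                = 0
qDegree p (white ∷ ts)      = qDegree (suc p) ts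
qDegree p (colourless ∷ ts) = qDegree (suc p) ts
qDegree p (black ∷ ts)      = suc p + qDegree (suc p) ts
qDegree p (domino ∷ ts)     = suc p + qDegree (suc (suc p)) ts

qDegree-∷ : ∀ τ p ts → qDegree p (τ ∷ ts) ≡ qDegree p [ τ ] + qDegree (len τ + p) ts
qDegree-∷ white      p ts = refl
qDegree-∷ colourless p ts = refl
qDegree-∷ black      p ts = cong (_+ qDegree (suc p) ts) (sym (+-identityʳ (suc p)))
qDegree-∷ domino     p ts = cong (_+ qDegree (suc (suc p)) ts) (sym (+-identityʳ (suc p)))

qDegree-++ : ∀ p xs ys → qDegree p (xs ++ ys) ≡ qDegree p xs + qDegree (cells xs + p) ys
qDegree-++ p []       ys = refl
qDegree-++ p (τ ∷ xs) ys = begin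
  qDegree p (τ ∷ xs ++ ys)                           ≡⟨ qDegree-∷ τ p (xs ++ ys) ⟩
  h + qDegree p′ (xs ++ ys)                          ≡⟨ cong (h +_) (qDegree-++ p′ xs ys) ⟩
  h + (qDegree p′ xs + qDegree (cells xs + p′) ys)   ≡⟨ cong (λ o → h + (qDegree p′ xs + qDegree o ys))
                                                             (+-rotate (cells xs) (len τ) p) ⟩
  h + (qDegree p′ xs + Y)                            ≡⟨ +-assoc h (qDegree p′ xs) Y ⟨
  (h + qDegree p′ xs) + Y                            ≡⟨ cong (_+ Y) (qDegree-∷ τ p xs) ⟨
  qDegree p (τ ∷ xs) + Y                             ∎
  where
  open ≡-Reasoning
  h  = qDegree p [ τ ]
  p′ = len τ + p
  Y  = qDegree (cells (τ ∷ xs) + p) ys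

-- slotDegree p ts sums, over the black squares and dominoes of ts, p plus the number of
-- cells covered by white and colourless squares before them: the part of the degree
-- that only depends on the slots of the moving tiles, not on which tile fills a slot.
slotDegree : ℕ → List Tile → ℕ
slotDegree p []                = 0
slotDegree p (white ∷ ts)      = slotDegree (suc p) ts
slotDegree p (colourless ∷ ts) = slotDegree (suc p) ts
slotDegree p (black ∷ ts)      = p + slotDegree p ts
slotDegree p (domino ∷ ts)     = p + slotDegree p ts

fill-arith : ∀ a p G E → suc (a + p) + (G + E) ≡ (p + G) + (suc a + E)
fill-arith = solve-∀

-- In the refill lemmas, a counts the cells covered by the moving tiles placed so far
-- and p those covered by white and colourless squares.
qDegree-fill : ∀ {m} → T (isMoving m) → ∀ {p G rest ms} →
               (∀ a → qDegree (a + p) rest ≡ G + qDegree a ms) →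
               ∀ a → qDegree (a + p) (m ∷ rest) ≡ (p + G) + qDegree a (m ∷ ms)
qDegree-fill {black}  _ {p} {G} ih a =
  trans (cong (suc (a + p) +_) (ih (suc a))) (fill-arith a p G _)
qDegree-fill {domino} _ {p} {G} ih a =
  trans (cong (suc (a + p) +_) (ih (suc (suc a)))) (fill-arith a p G _)

refill-qDegree : ∀ ts ms → Moving ms → length ms ≡ count isMoving ts →
                 ∀ a p → qDegree (a + p) (refill ts ms) ≡ slotDegree p ts + qDegree a ms
refill-qDegree [] [] _ _ a p = refl
refill-qDegree (white ∷ ts) ms mv h a p =
  trans (cong (λ o → qDegree o (refill ts ms)) (sym (+-suc a p)))
        (refill-qDegree ts ms mv h a (suc p))
refill-qDegree (colourless ∷ ts) ms mv h a p =
  trans (cong (λ o → qDegree o (refill ts ms)) (sym (+-suc a p)))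
        (refill-qDegree ts ms mv h a (suc p))
refill-qDegree (black ∷ ts) (m ∷ ms) (m↑ ∷ mv) h a p =
  qDegree-fill m↑ (λ a → refill-qDegree ts ms mv (suc-injective h) a p) a
refill-qDegree (domino ∷ ts) (m ∷ ms) (m↑ ∷ mv) h a p =
  qDegree-fill m↑ (λ a → refill-qDegree ts ms mv (suc-injective h) a p) a
refill-qDegree []           (_ ∷ _) _ ()
refill-qDegree (black ∷ _)  []      _ ()
refill-qDegree (domino ∷ _) []      _ ()

-- The degrees of the decoloured tiling (offset a) and of the domino-free tiling
-- (offset b) computed in one pass; every black square and domino contributes exactly
-- once, as in qDegree, which is what makes it compatible with refill.
splitDegree : ℕ → ℕ → List Tile → ℕ
splitDegree a b []                = 0
splitDegree a b (white ∷ ts)      = splitDegree (suc a) (suc b) ts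
splitDegree a b (colourless ∷ ts) = splitDegree (suc a) (suc b) ts
splitDegree a b (black ∷ ts)      = suc b + splitDegree (suc a) (suc b) ts
splitDegree a b (domino ∷ ts)     = suc a + splitDegree (suc (suc a)) b ts

splitDegree-decolour-deleteDominoes : ∀ a b ts →
  splitDegree a b ts ≡ qDegree a (map decolour ts) + qDegree b (deleteDominoes ts)
splitDegree-decolour-deleteDominoes a b [] = refl
splitDegree-decolour-deleteDominoes a b (white ∷ ts) =
  splitDegree-decolour-deleteDominoes (suc a) (suc b) ts
splitDegree-decolour-deleteDominoes a b (colourless ∷ ts) =
  splitDegree-decolour-deleteDominoes (suc a) (suc b) ts
splitDegree-decolour-deleteDominoes a b (black ∷ ts) =
  trans (cong (suc b +_) (splitDegree-decolour-deleteDominoes (suc a) (suc b) ts))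
        (+-leftComm (suc b) _ _)
splitDegree-decolour-deleteDominoes a b (domino ∷ ts) =
  trans (cong (suc a +_) (splitDegree-decolour-deleteDominoes (suc (suc a)) b ts))
        (sym (+-assoc (suc a) _ _))

splitDegree-fill : ∀ {m} → T (isMoving m) → ∀ {p G rest ms} →
  (∀ a b → splitDegree (a + p) (b + p) rest ≡ G + splitDegree a b ms) →
  ∀ a b → splitDegree (a + p) (b + p) (m ∷ rest) ≡ (p + G) + splitDegree a b (m ∷ ms)
splitDegree-fill {black}  _ {p} {G} ih a b =
  trans (cong (suc (b + p) +_) (ih (suc a) (suc b))) (fill-arith b p G _)
splitDegree-fill {domino} _ {p} {G} ih a b =
  trans (cong (suc (a + p) +_) (ih (suc (suc a)) b)) (fill-arith a p G _)

refill-splitDegree : ∀ ts ms → Moving ms → length ms ≡ count isMoving ts → ∀ a b p →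
  splitDegree (a + p) (b + p) (refill ts ms) ≡ slotDegree p ts + splitDegree a b ms
refill-splitDegree [] [] _ _ a b p = refl
refill-splitDegree (white ∷ ts) ms mv h a b p =
  trans (cong₂ (λ o o′ → splitDegree o o′ (refill ts ms)) (sym (+-suc a p)) (sym (+-suc b p)))
        (refill-splitDegree ts ms mv h a b (suc p))
refill-splitDegree (colourless ∷ ts) ms mv h a b p =
  trans (cong₂ (λ o o′ → splitDegree o o′ (refill ts ms)) (sym (+-suc a p)) (sym (+-suc b p)))
        (refill-splitDegree ts ms mv h a b (suc p))
refill-splitDegree (black ∷ ts) (m ∷ ms) (m↑ ∷ mv) h a b p =
  splitDegree-fill m↑ (λ a b → refill-splitDegree ts ms mv (suc-injective h) a b p) a b
refill-splitDegree (domino ∷ ts) (m ∷ ms) (m↑ ∷ mv) h a b p =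
  splitDegree-fill m↑ (λ a b → refill-splitDegree ts ms mv (suc-injective h) a b p) a b
refill-splitDegree []           (_ ∷ _) _ ()
refill-splitDegree (black ∷ _)  []      _ ()
refill-splitDegree (domino ∷ _) []      _ ()

splitDegree-shift : ∀ a b u v ts → splitDegree (a + u) (b + v) ts
  ≡ splitDegree a b ts + (u *ℕ count isDomino ts + v *ℕ count isBlack ts)
splitDegree-shift a b u v [] = sym (cong₂ _+_ (*-zeroʳ u) (*-zeroʳ v))
splitDegree-shift a b u v (white ∷ ts)      = splitDegree-shift (suc a) (suc b) u v ts
splitDegree-shift a b u v (colourless ∷ ts) = splitDegree-shift (suc a) (suc b) u v ts
splitDegree-shift a b u v (black ∷ ts) =
  trans (cong (suc (b + v) +_) (splitDegree-shift (suc a) (suc b) u v ts)) (arith b u v _ _ _)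
  where
  arith : ∀ b u v D B P → suc (b + v) + (P + (u *ℕ D + v *ℕ B))
                        ≡ (suc b + P) + (u *ℕ D + v *ℕ suc B)
  arith = solve-∀
splitDegree-shift a b u v (domino ∷ ts) =
  trans (cong (suc (a + u) +_) (splitDegree-shift (suc (suc a)) b u v ts)) (arith a u v _ _ _)
  where
  arith : ∀ a u v D B P → suc (a + u) + (P + (u *ℕ D + v *ℕ B))
                        ≡ (suc a + P) + (u *ℕ suc D + v *ℕ B)
  arith = solve-∀

cells-moving : ∀ {R} → Moving R → cells R ≡ 2 *ℕ count isDomino R + count isBlack R
cells-moving [] = refl
cells-moving {black ∷ R} (_ ∷ mv) =
  trans (cong suc (cells-moving mv)) (sym (+-suc (2 *ℕ count isDomino R) _))
cells-moving {domino ∷ R} (_ ∷ mv) =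
  trans (cong (2 +_) (cells-moving mv)) (arith (count isDomino R) _)
  where
  arith : ∀ D B → 2 + (2 *ℕ D + B) ≡ 2 *ℕ suc D + B
  arith = solve-∀

cells-reverse-moving : ∀ {R} → Moving R →
  cells (reverse R) ≡ 2 *ℕ count isDomino R + count isBlack R
cells-reverse-moving {R} mv =
  trans (cells-moving (All-resp-↭ (↭-sym (↭-reverse R)) mv))
        (cong₂ (λ d b → 2 *ℕ d + b) (count-↭ isDomino (↭-reverse R)) (count-↭ isBlack (↭-reverse R)))

qDegree-[moving] : ∀ {m} → T (isMoving m) → ∀ p → qDegree p [ m ] ≡ suc p
qDegree-[moving] {black}  _ p = +-identityʳ (suc p)
qDegree-[moving] {domino} _ p = +-identityʳ (suc p)

qDegree-reverse-∷ : ∀ {m R} → T (isMoving m) → Moving R →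
  qDegree 0 (reverse (m ∷ R)) ≡ qDegree 0 (reverse R) + suc (2 *ℕ count isDomino R + count isBlack R)
qDegree-reverse-∷ {m} {R} m↑ mv = begin
  qDegree 0 (reverse (m ∷ R))                ≡⟨ cong (qDegree 0) (unfold-reverse m R) ⟩
  qDegree 0 (reverse R ++ [ m ])             ≡⟨ qDegree-++ 0 (reverse R) [ m ] ⟩
  E + qDegree (cells (reverse R) + 0) [ m ]  ≡⟨ cong (E +_) (qDegree-[moving] m↑ _) ⟩
  E + suc (cells (reverse R) + 0)            ≡⟨ cong (λ n → E + suc n)
                                                     (trans (+-identityʳ _) (cells-reverse-moving mv)) ⟩
  E + suc (2 *ℕ count isDomino R + count isBlack R) ∎
  where
  open ≡-Reasoning
  E = qDegree 0 (reverse R)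

qDegree-reverse : ∀ R → Moving R →
  qDegree 0 (reverse R) ≡ count isDomino R *ℕ count isBlack R + splitDegree 0 0 R
qDegree-reverse [] [] = refl
qDegree-reverse (domino ∷ R) (d↑ ∷ mv) = begin
  qDegree 0 (reverse (domino ∷ R))          ≡⟨ qDegree-reverse-∷ d↑ mv ⟩
  qDegree 0 (reverse R) + suc (2 *ℕ D + B)  ≡⟨ cong (_+ suc (2 *ℕ D + B)) (qDegree-reverse R mv) ⟩
  (D *ℕ B + P) + suc (2 *ℕ D + B)           ≡⟨ arith D B P ⟩
  suc D *ℕ B + suc (P + (2 *ℕ D + 0 *ℕ B))  ≡⟨ cong (λ n → suc D *ℕ B + suc n) (splitDegree-shift 0 0 2 0 R) ⟨
  suc D *ℕ B + suc (splitDegree 2 0 R)      ∎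
  where
  open ≡-Reasoning
  D = count isDomino R
  B = count isBlack R
  P = splitDegree 0 0 R
  arith : ∀ D B P → (D *ℕ B + P) + suc (2 *ℕ D + B) ≡ suc D *ℕ B + suc (P + (2 *ℕ D + 0 *ℕ B))
  arith = solve-∀
qDegree-reverse (black ∷ R) (b↑ ∷ mv) = begin
  qDegree 0 (reverse (black ∷ R))           ≡⟨ qDegree-reverse-∷ b↑ mv ⟩
  qDegree 0 (reverse R) + suc (2 *ℕ D + B)  ≡⟨ cong (_+ suc (2 *ℕ D + B)) (qDegree-reverse R mv) ⟩
  (D *ℕ B + P) + suc (2 *ℕ D + B)           ≡⟨ arith D B P ⟩
  D *ℕ suc B + suc (P + (1 *ℕ D + 1 *ℕ B))  ≡⟨ cong (λ n → D *ℕ suc B + suc n) (splitDegree-shift 0 0 1 1 R) ⟨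
  D *ℕ suc B + suc (splitDegree 1 1 R)      ∎
  where
  open ≡-Reasoning
  D = count isDomino R
  B = count isBlack R
  P = splitDegree 0 0 R
  arith : ∀ D B P → (D *ℕ B + P) + suc (2 *ℕ D + B) ≡ D *ℕ suc B + suc (P + (1 *ℕ D + 1 *ℕ B))
  arith = solve-∀

qDegree-reverseMoving : ∀ t → qDegree 0 t ≡ count isDomino t *ℕ count isBlack t
  + (qDegree 0 (map decolour (reverseMoving t)) + qDegree 0 (deleteDominoes (reverseMoving t)))
qDegree-reverseMoving t = begin
  qDegree 0 t                  ≡⟨ cong (qDegree 0) (refill-filterᵇ-isMoving t) ⟨
  qDegree 0 (refill t M)       ≡⟨ refill-qDegree t M M↑ ∣M∣ 0 0 ⟩
  S + qDegree 0 M              ≡⟨ cong (λ xs → S + qDegree 0 xs) (reverse-involutive M) ⟨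
  S + qDegree 0 (reverse R)    ≡⟨ cong (S +_) (qDegree-reverse R R↑) ⟩
  S + (K′ + splitDegree 0 0 R) ≡⟨ cong (λ k → S + (k + splitDegree 0 0 R)) K′≡K ⟩
  S + (K + splitDegree 0 0 R)  ≡⟨ +-leftComm S K (splitDegree 0 0 R) ⟩
  K + (S + splitDegree 0 0 R)  ≡⟨ cong (K +_) (refill-splitDegree t R R↑ ∣R∣ 0 0 0) ⟨
  K + splitDegree 0 0 U        ≡⟨ cong (K +_) (splitDegree-decolour-deleteDominoes 0 0 U) ⟩
  K + (qDegree 0 (map decolour U) + qDegree 0 (deleteDominoes U)) ∎
  where
  open ≡-Reasoning
  U = reverseMoving t
  M = filterᵇ isMoving t
  R = reverse M
  M↑ = all-filter (T? ∘ isMoving) t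
  R↑ = All-resp-↭ (↭-sym (↭-reverse M)) M↑
  ∣M∣ = length-filterᵇ isMoving t
  ∣R∣ = trans (length-reverse M) ∣M∣
  S = slotDegree 0 t
  K = count isDomino t *ℕ count isBlack t
  K′ = count isDomino R *ℕ count isBlack R
  count-R : ∀ p → p white ≡ false → p colourless ≡ false → count p R ≡ count p t
  count-R p pw pc = trans (count-↭ p (↭-reverse M)) (count-filterᵇ-isMoving p pw pc t)
  K′≡K : K′ ≡ K
  K′≡K = cong₂ _*ℕ_ (count-R isDomino refl refl) (count-R isBlack refl refl)

module WeightFactorisation {c ℓ′ : Level} (R : CommutativeRing c ℓ′) where
  open CommutativeRing R
    using ( Carrier; _≈_; _*_; 1#; setoid; isEquivalence
          ; *-isCommutativeMonoid; *-commutativeSemigroup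
          ; *-assoc; *-cong; *-congˡ; *-congʳ; *-identityˡ )
    renaming (sym to ≈-sym; trans to ≈-trans)
  open CommutativeSemigroupProperties *-commutativeSemigroup using (interchange; x∙yz≈y∙xz)
  open SetoidPermutation setoid using (foldr-commMonoid)
  open SetoidReasoning setoid
  open Weight R

  ^-distribˡ-+-* : ∀ a m n → a ^ (m + n) ≈ a ^ m * a ^ n
  ^-distribˡ-+-* a zero    n = ≈-sym (*-identityˡ _)
  ^-distribˡ-+-* a (suc m) n = ≈-trans (*-congˡ (^-distribˡ-+-* a m n)) (≈-sym (*-assoc _ _ _))

  ^-gather : ∀ q m n a b → (q ^ m * a) * (q ^ n * b) ≈ q ^ (m + n) * (a * b)
  ^-gather q m n a b = ≈-trans (interchange _ _ _ _) (*-congʳ (≈-sym (^-distribˡ-+-* q m n)))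

  module _ (r x s : Carrier) where

    tileWeight : Tile → Carrier
    tileWeight white      = x
    tileWeight black      = r * x
    tileWeight colourless = 1#
    tileWeight domino     = s

    plainWeight : List Tile → Carrier
    plainWeight ts = foldr _*_ 1# (map tileWeight ts)

    plainWeight-↭ : ∀ {xs ys} → xs ↭ ys → plainWeight xs ≈ plainWeight ys
    plainWeight-↭ xs↭ys =
      foldr-commMonoid *-isCommutativeMonoid (↭⇒↭ₛ′ isEquivalence (map⁺ tileWeight xs↭ys))

    split-square : ∀ a {P PA PB} → P ≈ PA * PB → a * P ≈ (1# * PA) * (a * PB)
    split-square a e =
      ≈-trans (*-congˡ e) (≈-trans (x∙yz≈y∙xz a _ _) (*-congʳ (≈-sym (*-identityˡ _))))

    plainWeight-decolour-deleteDominoes : ∀ ts →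
      plainWeight ts ≈ plainWeight (map decolour ts) * plainWeight (deleteDominoes ts)
    plainWeight-decolour-deleteDominoes [] = ≈-sym (*-identityˡ 1#)
    plainWeight-decolour-deleteDominoes (white ∷ ts) =
      split-square x (plainWeight-decolour-deleteDominoes ts)
    plainWeight-decolour-deleteDominoes (black ∷ ts) =
      split-square (r * x) (plainWeight-decolour-deleteDominoes ts)
    plainWeight-decolour-deleteDominoes (colourless ∷ ts) =
      split-square 1# (plainWeight-decolour-deleteDominoes ts)
    plainWeight-decolour-deleteDominoes (domino ∷ ts) =
      ≈-trans (*-congˡ (plainWeight-decolour-deleteDominoes ts)) (≈-sym (*-assoc _ _ _))

    weightFrom-factorisation : ∀ q p ts →
      weightFrom q r x s p ts ≈ q ^ qDegree p ts * plainWeight ts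
    weightFrom-factorisation q p [] = ≈-sym (*-identityˡ 1#)
    weightFrom-factorisation q p (white ∷ ts) =
      ≈-trans (*-congˡ (weightFrom-factorisation q (suc p) ts)) (x∙yz≈y∙xz x _ _)
    weightFrom-factorisation q p (colourless ∷ ts) =
      ≈-trans (weightFrom-factorisation q (suc p) ts) (*-congˡ (≈-sym (*-identityˡ _)))
    weightFrom-factorisation q p (black ∷ ts) =
      ≈-trans (*-cong (*-assoc _ _ _) (weightFrom-factorisation q (suc p) ts))
              (^-gather q (suc p) _ (r * x) _)
    weightFrom-factorisation q p (domino ∷ ts) =
      ≈-trans (*-congˡ (weightFrom-factorisation q (suc (suc p)) ts)) (^-gather q (suc p) _ s _)

    w-reverseMoving : ∀ q t → w q r x s t ≈ q ^ (count isDomino t *ℕ count isBlack t) *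
      (w q r x s (map decolour (reverseMoving t)) * w q r x s (deleteDominoes (reverseMoving t)))
    w-reverseMoving q t = begin
      w q r x s t                               ≈⟨ weightFrom-factorisation q 0 t ⟩
      q ^ qDegree 0 t * π t                     ≡⟨ cong (λ e → q ^ e * π t) (qDegree-reverseMoving t) ⟩
      q ^ (K + (EA + EB)) * π t                 ≈⟨ *-congˡ (plainWeight-↭ (↭-sym (reverseMoving-↭ t))) ⟩
      q ^ (K + (EA + EB)) * π U                 ≈⟨ *-congˡ (plainWeight-decolour-deleteDominoes U) ⟩
      q ^ (K + (EA + EB)) * (π A * π B)         ≈⟨ *-congʳ (^-distribˡ-+-* q K (EA + EB)) ⟩
      (q ^ K * q ^ (EA + EB)) * (π A * π B)     ≈⟨ *-assoc _ _ _ ⟩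
      q ^ K * (q ^ (EA + EB) * (π A * π B))     ≈⟨ *-congˡ (^-gather q EA EB _ _) ⟨
      q ^ K * ((q ^ EA * π A) * (q ^ EB * π B)) ≈⟨ *-congˡ (*-cong (weightFrom-factorisation q 0 A)
                                                                     (weightFrom-factorisation q 0 B)) ⟨
      q ^ K * (w q r x s A * w q r x s B)       ∎
      where
      π = plainWeight
      U = reverseMoving t
      A = map decolour U
      B = deleteDominoes U
      K = count isDomino t *ℕ count isBlack t
      EA = qDegree 0 A
      EB = qDegree 0 B

proposition2p4 : {c ℓ' : Level} (R : CommutativeRing c ℓ') →
  let open CommutativeRing R
      open Weight R
  in (q r x s : Carrier) → ¬ (q ≈ - 1#) →
     (n k ℓ : ℕ) (t : List Tile) →
     cells t ≡ n → count isDomino t ≡ k → count isBlack t ≡ ℓ →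
     w q r x s t ≈ (q ^ (k *ℕ ℓ)) * (w q r x s (map decolour (reverseMoving t)) * w q r x s (deleteDominoes (reverseMoving t)))
proposition2p4 R q r x s _ n k ℓ t _ refl refl = WeightFactorisation.w-reverseMoving R r x s q t
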